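{- Let $G=(V,E)$ be a connected graph with $n\ge1$ vertices and let $N$ be a positive integer. Then there are at most $2N\cdot 5^{n-1}$ triples $(A,f,\bar f)$ such that $(A,f)$ is a partial bucket function of $G$ and $\bar f$ is a bucket extension of $f$ satisfying $\bar f(V)\subseteq\{1,2,\dots,N\}$.
   Context: For $A\subseteq V$ and $f:A\to\mathbb{Z}$, a bucket extension of $f$ is a function $\bar f:V\to\mathbb{Z}$ with: (1) $\bar f|_A=f$; (2) $|\bar f(u)-\bar f(v)|\le1$ for every edge $uv\in E$; (3) $\bar f(u)\ge\bar f(v)$ for every edge $uv\in E$ with $u\in A$, $v\notin A$. A partial bucket function is a pair $(A,f)$, $A\subseteq V$, $f:A\to\mathbb{Z}$, such that $f$ has a bucket extension. -}

module Defs where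

open import Data.Nat using (ℕ; zero; suc)
open import Data.Fin using (Fin)
open import Data.Fin.Subset using (Subset; _∈_; _∉_)
open import Data.Integer using (ℤ; +_; _≤_; _-_; ∣_∣)
import Data.Nat as ℕ
open import Data.Product using (Σ; _×_; _,_)
open import Data.List using (List)
open import Relation.Nullary using (¬_; Dec)
open import Relation.Binary.PropositionalEquality using (_≡_)

record Graph (n : ℕ) : Set₁ where
  field
    Adj     : Fin n → Fin n → Set
    adj?    : ∀ u v → Dec (Adj u v)
    sym     : ∀ {u v} → Adj u v → Adj v u
    irrefl  : ∀ {u} → ¬ Adj u u

data Walk {n : ℕ} (G : Graph n) : Fin n → Fin n → Set where
  here : ∀ {u} → Walk G u u
  step : ∀ {u w v} → Graph.Adj G u w → Walk G w v → Walk G u v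

Connected : ∀ {n} → Graph n → Set
Connected G = ∀ u v → Walk G u v

PartialFun : ∀ {n} → Subset n → Set
PartialFun {n} A = (v : Fin n) → v ∈ A → ℤ

IsBucketExtension : ∀ {n} (G : Graph n) (A : Subset n) (f : PartialFun A)
                    (fbar : Fin n → ℤ) → Set
IsBucketExtension {n} G A f fbar =
    (∀ v (p : v ∈ A) → fbar v ≡ f v p)
  × (∀ u v → Graph.Adj G u v → ∣ fbar u - fbar v ∣ ℕ.≤ 1)
  × (∀ u v → Graph.Adj G u v → u ∈ A → v ∉ A → fbar v ≤ fbar u)

IsPartialBucketFunction : ∀ {n} (G : Graph n) (A : Subset n) (f : PartialFun A) → Set
IsPartialBucketFunction {n} G A f = Σ (Fin n → ℤ) (IsBucketExtension G A f)

Triple : ℕ → Set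
Triple n = Σ (Subset n) (λ A → PartialFun A × (Fin n → ℤ))

IsCountedTriple : ∀ {n} (G : Graph n) (N : ℕ) → Triple n → Set
IsCountedTriple G N (A , f , fbar) =
    IsPartialBucketFunction G A f
  × IsBucketExtension G A f fbar
  × (∀ v → (+ 1 ≤ fbar v × fbar v ≤ + N))

SameTriple : ∀ {n} → Triple n → Triple n → Set
SameTriple {n} (A , f , fbar) (A' , f' , fbar') =
    A ≡ A'
  × (∀ v (p : v ∈ A) (p' : v ∈ A') → f v p ≡ f' v p')
  × (∀ v → fbar v ≡ fbar' v)

module Submission where

-- Fix a spanning growth sequence of the connected graph G: a root r and an
-- ordering of the other vertices in which each vertex v is attached by an edge
-- uv to an earlier vertex u; it has k ≤ m edges.  A counted triple
-- (A , f , fbar) is determined by its labelling v ↦ (v ∈ A , fbar v), since f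
-- is fbar restricted to A.  The labelling in turn is determined by
--   * the label of the root: 2 · N possibilities, as fbar r ∈ {1,…,N};
--   * one of 5 digits per tree edge uv: given the label of u, the digit tells
--     whether v ∈ A and the step fbar v - fbar u ∈ {-1,0,1}.  The bucket
--     condition forbids stepping up when leaving A and stepping down when
--     entering A, so 3 steps stay on one side of A and 2 cross: 5 cases.
-- Hence counted triples inject into Fin (2 · N · 5 ^ k), bounding any list of
-- pairwise distinct ones.

open import Defs
open import Data.Nat using (ℕ; suc; _≤_; _*_; _^_; NonZero)
open import Data.List using (List; length)
open import Data.List.Relation.Unary.All using (All)
open import Data.List.Relation.Unary.AllPairs using (AllPairs)
open import Relation.Nullary using (¬_)

open import Data.Nat using (zero; _+_; s≤s; s≤s⁻¹)
open import Data.Nat.Properties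
  using (≤-trans; m≤m+n; +-suc; 1+n≰n; *-monoʳ-≤; ^-monoʳ-≤)
open import Data.Bool using (Bool; true; false; not)
open import Data.Fin using (Fin; toℕ; fromℕ<; combine)
open import Data.Fin.Patterns using (0F; 1F; 2F; 3F; 4F)
open import Data.Fin.Properties
  using (injective⇒≤; combine-injective; toℕ-fromℕ<; all?; ¬∀⟶∃¬)
open import Data.Vec using (Vec; []; _∷_; lookup; tabulate)
open import Data.Vec.Properties
  using (∷-injective; tabulate∘lookup; tabulate-cong; lookup⇒[]=; []=⇒lookup)
open import Data.Fin.Subset using () renaming (_∈_ to _∈ₛ_)
open import Data.Integer using (ℤ; +_; -[1+_]; 0ℤ; _-_; ∣_∣; +≤+)
  renaming (_+_ to _+ℤ_; _≤_ to _≤ℤ_)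
open import Data.Integer.Properties using (i≤j⇒i-j≤0; i≤j⇒0≤j-i)
open import Data.Integer.Tactic.RingSolver using (solve-∀)
open import Data.Product using (Σ; _×_; _,_; proj₁; proj₂)
open import Data.Unit using (⊤; tt)
open import Data.Empty using (⊥; ⊥-elim)
import Data.List as List
import Data.List.Relation.Unary.All as All
open import Data.List.Relation.Unary.All.Properties.Core using (¬Any⇒All¬)
open import Data.List.Membership.Propositional using (_∈_; _∉_)
open import Data.List.Membership.Propositional.Properties using (∈-lookup)
import Data.List.Membership.DecPropositional as DecMembership
open import Data.List.Relation.Unary.Any using (here; there)
open import Relation.Nullary using (yes; no)
open import Relation.Binary.PropositionalEquality
  using (_≡_; _≢_; refl; sym; trans; cong; cong₂; subst; module ≡-Reasoning)

module CountByCode {A : Set} {P : A → Set} {R : A → A → Set} {k : ℕ}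
                   (code : ∀ x → P x → Fin k)
                   (sound : ∀ {x y} (p : P x) (q : P y) → code x p ≡ code y q → R x y)
                   where

  codeAt : ∀ {xs} → All P xs → Fin (length xs) → Fin k
  codeAt {xs} ps i = code (List.lookup xs i) (All.lookup ps (∈-lookup i))

  codeAt-injective : ∀ {xs} (ps : All P xs) → AllPairs (λ x y → ¬ R x y) xs →
                     ∀ i j → codeAt ps i ≡ codeAt ps j → i ≡ j
  codeAt-injective (_ All.∷ _)  _                    0F 0F _ = refl
  codeAt-injective (_ All.∷ _)  (avoid AllPairs.∷ _) 0F (Fin.suc j) e =
    ⊥-elim (All.lookup avoid (∈-lookup j) (sound _ _ e))
  codeAt-injective (_ All.∷ _)  (avoid AllPairs.∷ _) (Fin.suc i) 0F e =
    ⊥-elim (All.lookup avoid (∈-lookup i) (sound _ _ (sym e)))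
  codeAt-injective (_ All.∷ ps) (_ AllPairs.∷ distinct) (Fin.suc i) (Fin.suc j) e =
    cong Fin.suc (codeAt-injective ps distinct i j e)

  length≤-by-code : ∀ {xs} → All P xs → AllPairs (λ x y → ¬ R x y) xs → length xs ≤ k
  length≤-by-code ps distinct = injective⇒≤ (codeAt-injective ps distinct _ _)

open CountByCode using (length≤-by-code)

distinct⇒length≤ : ∀ {n} {xs : List (Fin n)} → AllPairs _≢_ xs → length xs ≤ n
distinct⇒length≤ {xs = xs} =
  length≤-by-code {P = λ _ → ⊤} (λ x _ → x) (λ _ _ e → e) (All.universal (λ _ → tt) xs)

digitsCode : ∀ {b k} → Vec (Fin b) k → Fin (b ^ k)
digitsCode []       = 0F
digitsCode (d ∷ ds) = combine d (digitsCode ds)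

digitsCode-injective : ∀ {b k} {ds es : Vec (Fin b) k} →
                       digitsCode ds ≡ digitsCode es → ds ≡ es
digitsCode-injective {ds = []}     {[]}     _ = refl
digitsCode-injective {ds = d ∷ ds} {e ∷ es} eq
  with combine-injective d (digitsCode ds) e (digitsCode es) eq
... | d≡e , rest = cong₂ _∷_ d≡e (digitsCode-injective rest)

lookup-extensional : ∀ {A : Set} {n} (xs ys : Vec A n) →
                     (∀ i → lookup xs i ≡ lookup ys i) → xs ≡ ys
lookup-extensional xs ys same = begin
  xs                  ≡⟨ tabulate∘lookup xs ⟨
  tabulate (lookup xs) ≡⟨ tabulate-cong same ⟩
  tabulate (lookup ys) ≡⟨ tabulate∘lookup ys ⟩
  ys                  ∎
  where open ≡-Reasoning

module GrowthSequences {n : ℕ} (G : Graph n) where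
  open Graph G using (Adj)
  open DecMembership (Data.Fin._≟_ {n}) using (_∈?_)

  -- It is a spanning tree given with a build order.
  data Growth (r : Fin n) : ℕ → List (Fin n) → Set where
    start  : Growth r 0 (r List.∷ List.[])
    attach : ∀ {k vs} → Growth r k vs → (u v : Fin n) →
             u ∈ vs → v ∉ vs → Adj u v → Growth r (suc k) (v List.∷ vs)

  root∈ : ∀ {r k vs} → Growth r k vs → r ∈ vs
  root∈ start                = here refl
  root∈ (attach t _ _ _ _ _) = there (root∈ t)

  growth-distinct : ∀ {r k vs} → Growth r k vs → AllPairs _≢_ vs
  growth-distinct start = All.[] AllPairs.∷ AllPairs.[]
  growth-distinct (attach t _ _ _ v∉ _) = ¬Any⇒All¬ _ v∉ AllPairs.∷ growth-distinct t

  growth-length : ∀ {r k vs} → Growth r k vs → length vs ≡ suc k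
  growth-length start                = refl
  growth-length (attach t _ _ _ _ _) = cong suc (growth-length t)

  growth-steps<n : ∀ {r k vs} → Growth r k vs → suc k ≤ n
  growth-steps<n t = subst (_≤ n) (growth-length t) (distinct⇒length≤ (growth-distinct t))

  exitEdge : ∀ {vs a b} → Walk G a b → a ∈ vs → b ∉ vs →
             Σ (Fin n) λ u → Σ (Fin n) λ v → u ∈ vs × v ∉ vs × Adj u v
  exitEdge here a∈ b∉ = ⊥-elim (b∉ a∈)
  exitEdge {vs} {a} (step {w = w} aw rest) a∈ b∉ with w ∈? vs
  ... | yes w∈ = exitEdge rest w∈ b∉
  ... | no w∉  = a , w , a∈ , w∉ , aw

  record Spanning (r : Fin n) : Set where
    field
      steps    : ℕ
      vertices : List (Fin n)
      growth   : Growth r steps vertices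
      covers   : ∀ w → w ∈ vertices

  -- Attach exit edges until every vertex is listed.  The fuel bounds the
  -- number of further steps; running out of fuel would produce a growth
  -- sequence with more than n distinct vertices.
  extend : Connected G → ∀ fuel {r k vs} → Growth r k vs → n ≤ fuel + suc k → Spanning r
  extend conn fuel {r} {k} {vs} t bound with all? (_∈? vs)
  ... | yes covers = record { growth = t ; covers = covers }
  ... | no ¬covers with ¬∀⟶∃¬ n (_∈ vs) (_∈? vs) ¬covers
  ... | w , w∉ with exitEdge (conn r w) (root∈ t) w∉
  ... | u , v , u∈ , v∉ , uv with fuel
  ... | suc fuel = extend conn fuel t′ (subst (n ≤_) (sym (+-suc fuel (suc k))) bound)
    where t′ = attach t u v u∈ v∉ uv
  ... | zero = ⊥-elim (1+n≰n (≤-trans (growth-steps<n (attach t u v u∈ v∉ uv)) bound))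

  spanning : Connected G → (r : Fin n) → Spanning r
  spanning conn r = extend conn n start (m≤m+n n 1)

  module Reconstruction {L C : Set} (encode : L → L → C) (decode : L → C → L) where

    EdgeDecodable : (Fin n → L) → Set
    EdgeDecodable ℓ = ∀ u v → Adj u v → decode (ℓ u) (encode (ℓ u) (ℓ v)) ≡ ℓ v

    edgeCodes : ∀ {r k vs} → (Fin n → L) → Growth r k vs → Vec C k
    edgeCodes ℓ start                = []
    edgeCodes ℓ (attach t u v _ _ _) = encode (ℓ u) (ℓ v) ∷ edgeCodes ℓ t

    reconstruct : ∀ {ℓ ℓ′ r k vs} → EdgeDecodable ℓ → EdgeDecodable ℓ′ →
                  (t : Growth r k vs) → edgeCodes ℓ t ≡ edgeCodes ℓ′ t →
                  ℓ r ≡ ℓ′ r → All (λ x → ℓ x ≡ ℓ′ x) vs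
    reconstruct _ _ start _ sameRoot = sameRoot All.∷ All.[]
    reconstruct {ℓ} {ℓ′} dec dec′ (attach t u v u∈ _ uv) codes sameRoot =
      sameAt-v All.∷ sameOn-t
      where
        sameOn-t = reconstruct dec dec′ t (proj₂ (∷-injective codes)) sameRoot
        sameAt-v : ℓ v ≡ ℓ′ v
        sameAt-v = begin
          ℓ v                                   ≡⟨ dec u v uv ⟨
          decode (ℓ u) (encode (ℓ u) (ℓ v))     ≡⟨ cong₂ decode (All.lookup sameOn-t u∈)
                                                          (proj₁ (∷-injective codes)) ⟩
          decode (ℓ′ u) (encode (ℓ′ u) (ℓ′ v))  ≡⟨ dec′ u v uv ⟩
          ℓ′ v                                  ∎
          where open ≡-Reasoning

data Slope : Set where
  down flat up : Slope

rise : Slope → ℤ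
rise down = -[1+ 0 ]
rise flat = + 0
rise up   = + 1

-- The slope of an integer step (meaningful for steps in {-1,0,1}).
slope : ℤ → Slope
slope -[1+ 0 ] = down
slope (+ 1)    = up
slope _        = flat

rise-slope : ∀ d → ∣ d ∣ ≤ 1 → rise (slope d) ≡ d
rise-slope -[1+ 0 ]        _ = refl
rise-slope (+ 0)           _ = refl
rise-slope (+ 1)           _ = refl
rise-slope -[1+ suc _ ]    (s≤s ())
rise-slope (+ suc (suc _)) (s≤s ())

Admissible : Bool → Bool → Slope → Set
Admissible true  false up   = ⊥
Admissible false true  down = ⊥
Admissible _     _     _    = ⊤

slope≤0-admissible : ∀ d → d ≤ℤ 0ℤ → Admissible true false (slope d)
slope≤0-admissible -[1+ 0 ]        _ = tt
slope≤0-admissible -[1+ suc _ ]    _ = tt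
slope≤0-admissible (+ 0)           _ = tt
slope≤0-admissible (+ suc (suc _)) _ = tt
slope≤0-admissible (+ 1)           (+≤+ ())

slope≥0-admissible : ∀ d → 0ℤ ≤ℤ d → Admissible false true (slope d)
slope≥0-admissible (+ 0)           _ = tt
slope≥0-admissible (+ 1)           _ = tt
slope≥0-admissible (+ suc (suc _)) _ = tt
slope≥0-admissible -[1+ _ ]        ()

crossing : Bool → Slope
crossing true  = down
crossing false = up

digit : Bool → Bool → Slope → Fin 5
digit true  true  down = 0F
digit true  true  flat = 1F
digit true  true  up   = 2F
digit false false down = 0F
digit false false flat = 1F
digit false false up   = 2F
digit true  false down = 3F
digit false true  up   = 3F
digit _     _     _    = 4F

undigit : Bool → Fin 5 → Bool × Slope
undigit a 0F = a , down
undigit a 1F = a , flat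
undigit a 2F = a , up
undigit a 3F = not a , crossing a
undigit a 4F = not a , flat

undigit-digit : ∀ a b s → Admissible a b s → undigit a (digit a b s) ≡ (b , s)
undigit-digit true  true  down _ = refl
undigit-digit true  true  flat _ = refl
undigit-digit true  true  up   _ = refl
undigit-digit false false down _ = refl
undigit-digit false false flat _ = refl
undigit-digit false false up   _ = refl
undigit-digit true  false down _ = refl
undigit-digit true  false flat _ = refl
undigit-digit false true  flat _ = refl
undigit-digit false true  up   _ = refl

-- A vertex label: membership in A and the value of fbar.
Label : Set
Label = Bool × ℤ

encodeEdge : Label → Label → Fin 5
encodeEdge (a , x) (b , y) = digit a b (slope (y - x))

decodeEdge : Label → Fin 5 → Label
decodeEdge (a , x) c = proj₁ (undigit a c) , x +ℤ rise (proj₂ (undigit a c))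

x+[y-x]≡y : ∀ x y → x +ℤ (y - x) ≡ y
x+[y-x]≡y = solve-∀

BucketEdge : Label → Label → Set
BucketEdge (a , x) (b , y) =
    ∣ y - x ∣ ≤ 1
  × (a ≡ true → b ≡ false → y ≤ℤ x)
  × (a ≡ false → b ≡ true → x ≤ℤ y)

admissible : ∀ p q → BucketEdge p q → Admissible (proj₁ p) (proj₁ q) (slope (proj₂ q - proj₂ p))
admissible (true  , x) (true  , y) _ = tt
admissible (false , x) (false , y) _ = tt
admissible (true  , x) (false , y) (_ , leave , _) = slope≤0-admissible _ (i≤j⇒i-j≤0 (leave refl refl))
admissible (false , x) (true  , y) (_ , _ , enter) = slope≥0-admissible _ (i≤j⇒0≤j-i (enter refl refl))

decode-encode : ∀ p q → BucketEdge p q → decodeEdge p (encodeEdge p q) ≡ q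
decode-encode p@(a , x) q@(b , y) edge@(close , _) = begin
  decodeEdge p (encodeEdge p q)
    ≡⟨ cong (λ bs → proj₁ bs , x +ℤ rise (proj₂ bs)) (undigit-digit a b _ (admissible p q edge)) ⟩
  b , x +ℤ rise (slope (y - x))   ≡⟨ cong (λ z → b , x +ℤ z) (rise-slope (y - x) close) ⟩
  b , x +ℤ (y - x)                ≡⟨ cong (b ,_) (x+[y-x]≡y x y) ⟩
  b , y                           ∎
  where open ≡-Reasoning

labelling : ∀ {n} → Triple n → Fin n → Label
labelling (A , _ , fbar) v = lookup A v , fbar v

bitCode : Bool → Fin 2
bitCode false = 0F
bitCode true  = 1F

bitCode-injective : ∀ {a b} → bitCode a ≡ bitCode b → a ≡ b
bitCode-injective {false} {false} _ = refl
bitCode-injective {true}  {true}  _ = refl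

valueCode : ∀ {N} (x : ℤ) → + 1 ≤ℤ x → x ≤ℤ + N → Fin N
valueCode (+ suc k) _        (+≤+ k<N) = fromℕ< k<N
valueCode (+ 0)     (+≤+ ()) _

valueCode-correct : ∀ {N} x (p : + 1 ≤ℤ x) (q : x ≤ℤ + N) → + suc (toℕ (valueCode x p q)) ≡ x
valueCode-correct (+ suc k) _        (+≤+ k<N) = cong (λ i → + suc i) (toℕ-fromℕ< k<N)
valueCode-correct (+ 0)     (+≤+ ()) _

valueCode-injective : ∀ {N x y} {p : + 1 ≤ℤ x} {q : x ≤ℤ + N} {p′ : + 1 ≤ℤ y} {q′ : y ≤ℤ + N} →
                      valueCode x p q ≡ valueCode y p′ q′ → x ≡ y
valueCode-injective {x = x} {y} {p} {q} {p′} {q′} eq = begin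
  x                                ≡⟨ valueCode-correct x p q ⟨
  + suc (toℕ (valueCode x p q))    ≡⟨ cong (λ i → + suc (toℕ i)) eq ⟩
  + suc (toℕ (valueCode y p′ q′))  ≡⟨ valueCode-correct y p′ q′ ⟩
  y                                ∎
  where open ≡-Reasoning

module TripleCode {n} (G : Graph n) (N : ℕ) where
  open GrowthSequences G
  open Reconstruction encodeEdge decodeEdge

  extension-decodable : ∀ {A f fbar} → IsBucketExtension G A f fbar →
                        EdgeDecodable (labelling (A , f , fbar))
  extension-decodable {A} {f} {fbar} (_ , close , downhill) u v uv =
    decode-encode (labelling τ u) (labelling τ v) (close v u (Graph.sym G uv) , leave , enter)
    where
      τ = (A , f , fbar)
      member : ∀ w → lookup A w ≡ true → w ∈ₛ A
      member w = lookup⇒[]= w A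
      nonMember : ∀ w → lookup A w ≡ false → ¬ w ∈ₛ A
      nonMember w out w∈ with trans (sym ([]=⇒lookup w∈)) out
      ... | ()
      leave : lookup A u ≡ true → lookup A v ≡ false → fbar v ≤ℤ fbar u
      leave u∈ v∉ = downhill u v uv (member u u∈) (nonMember v v∉)
      enter : lookup A u ≡ false → lookup A v ≡ true → fbar u ≤ℤ fbar v
      enter u∉ v∈ = downhill v u (Graph.sym G uv) (member v v∈) (nonMember u u∉)

  module _ {r k vs} (t : Growth r k vs) (covers : ∀ w → w ∈ vs) where

    tripleCode : (τ : Triple n) → IsCountedTriple G N τ → Fin (2 * N * 5 ^ k)
    tripleCode τ@(A , f , fbar) (_ , _ , range) =
      combine (combine (bitCode (lookup A r)) (valueCode (fbar r) (proj₁ (range r)) (proj₂ (range r))))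
              (digitsCode (edgeCodes (labelling τ) t))

    tripleCode-sound : ∀ {τ τ′} (c : IsCountedTriple G N τ) (c′ : IsCountedTriple G N τ′) →
                       tripleCode τ c ≡ tripleCode τ′ c′ → SameTriple τ τ′
    tripleCode-sound {A , f , fbar} {A′ , f′ , fbar′} (_ , ext , _) (_ , ext′ , _) eq =
      sameSet , sameFun , sameValue
      where
        codes = combine-injective _ _ _ _ eq
        root = combine-injective _ _ _ _ (proj₁ codes)
        sameRoot : labelling (A , f , fbar) r ≡ labelling (A′ , f′ , fbar′) r
        sameRoot = cong₂ _,_ (bitCode-injective (proj₁ root)) (valueCode-injective {N} (proj₂ root))
        sameLabel : ∀ v → labelling (A , f , fbar) v ≡ labelling (A′ , f′ , fbar′) v
        sameLabel v = All.lookup (reconstruct (extension-decodable ext) (extension-decodable ext′)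
                                    t (digitsCode-injective (proj₂ codes)) sameRoot) (covers v)
        sameSet : A ≡ A′
        sameSet = lookup-extensional A A′ (λ v → cong proj₁ (sameLabel v))
        sameValue : ∀ v → fbar v ≡ fbar′ v
        sameValue v = cong proj₂ (sameLabel v)
        sameFun : ∀ v p p′ → f v p ≡ f′ v p′
        sameFun v p p′ = trans (sym (proj₁ ext v p)) (trans (sameValue v) (proj₁ ext′ v p′))

lemma2 : (m : ℕ) (G : Graph (suc m)) → Connected G →
         (N : ℕ) → .{{_ : NonZero N}} →
         (ts : List (Triple (suc m))) →
         All (IsCountedTriple G N) ts →
         AllPairs (λ s t → ¬ SameTriple s t) ts →
         length ts ≤ 2 * N * 5 ^ m
lemma2 m G conn N ts counted distinct =
  ≤-trans (length≤-by-code (tripleCode growth covers) (tripleCode-sound growth covers) counted distinct)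
          (*-monoʳ-≤ (2 * N) (^-monoʳ-≤ 5 steps≤m))
  where
    open GrowthSequences G using (module Spanning; spanning; growth-steps<n)
    open Spanning (spanning conn 0F)
    open TripleCode G N
    steps≤m : steps ≤ m
    steps≤m = s≤s⁻¹ (growth-steps<n growth)
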